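{- Let $n$ be a positive integer. If $A$ is a finite subdirectly irreducible cascade Heyting algebra that does not have width at most $n$, then $A$ refutes $\mathcal{J}(F_{n+1})$ or $A$ refutes $\mathcal{J}(D_{n+1})$.
   Context: A Heyting algebra is a cascade Heyting algebra if it validates the weak Peirce law $(p\to q)\vee(((q\to p)\to q)\to q)\approx1$. ${\uparrow}x=\{y:x\le y\}$; a poset has width at most $n$ if no ${\uparrow}x$ contains an antichain of $n+1$ elements; a Heyting algebra has width at most $n$ if its poset of prime filters (ordered by inclusion) does. $\mathrm{Up}(X)$ is the Heyting algebra of upsets of a poset $X$. For a finite subdirectly irreducible Heyting algebra $C$, its Jankov formula $\mathcal{J}(C)$ is a formula such that for every Heyting algebra $B$: $B$ validates $\mathcal{J}(C)$ iff $C$ is not isomorphic to a subalgebra of a homomorphic image of $B$; for a finite rooted poset $P$, $\mathcal{J}(P)=\mathcal{J}(\mathrm{Up}(P))$. $F_m$ is the poset consisting of a root and $m$ pairwise incomparable elements above it; $D_m$ consists of a bottom, a top, and $m$ pairwise incomparable elements strictly between them. -}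

module Defs where

open import Level using (0ℓ; Level)
open import Data.Nat using (ℕ; zero; suc)
open import Data.Fin using (Fin; zero; suc; _≟_)
open import Data.Fin.Properties using (all?)
open import Data.Bool using (Bool; true; false; T) renaming (_∧_ to _∧ᵇ_; _∨_ to _∨ᵇ_)
open import Data.Bool.Properties using (T-∧; T-∨)
open import Data.Product using (Σ; _×_; _,_; proj₁; proj₂; ∃)
open import Data.Sum using (_⊎_; inj₁; inj₂)
open import Function.Bundles using (Equivalence)
open import Relation.Nullary using (¬_; does; Dec; isYes)
open import Relation.Nullary.Decidable using (T?; _→-dec_; toWitness; fromWitness)
open import Relation.Binary.PropositionalEquality using (_≡_; refl) renaming (cong to ≡-cong; trans to ≡-trans)
open import Relation.Binary.Lattice.Bundles using (HeytingAlgebra)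

-- All Heyting algebras considered live in universe level 0
-- (finite algebras, so this is no loss of generality).
HA : Set₁
HA = HeytingAlgebra 0ℓ 0ℓ 0ℓ

module _ (A : HA) where
  open HeytingAlgebra A

  Finite : Set
  Finite = Σ ℕ λ k → Σ (Carrier → Fin k) λ to → Σ (Fin k → Carrier) λ from →
             (∀ x → from (to x) ≈ x) × (∀ i → to (from i) ≡ i)
             × (∀ {x y} → x ≈ y → to x ≡ to y)

  -- the weak Peirce law (p → q) ∨ (((q → p) → q) → q) ≈ 1
  Cascade : Set
  Cascade = ∀ p q → ((p ⇨ q) ∨ (((q ⇨ p) ⇨ q) ⇨ q)) ≈ ⊤

  record Congruence : Set₁ where
    field
      θ      : Carrier → Carrier → Set
      refl′  : ∀ {x y} → x ≈ y → θ x y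
      sym′   : ∀ {x y} → θ x y → θ y x
      trans′ : ∀ {x y z} → θ x y → θ y z → θ x z
      ∧-cong : ∀ {x x′ y y′} → θ x x′ → θ y y′ → θ (x ∧ y) (x′ ∧ y′)
      ∨-cong : ∀ {x x′ y y′} → θ x x′ → θ y y′ → θ (x ∨ y) (x′ ∨ y′)
      ⇨-cong : ∀ {x x′ y y′} → θ x x′ → θ y y′ → θ (x ⇨ y) (x′ ⇨ y′)

  NontrivialCong : Congruence → Set
  NontrivialCong c = Σ Carrier λ x → Σ Carrier λ y → Congruence.θ c x y × ¬ (x ≈ y)

  -- subdirectly irreducible: there is a pair of distinct elements identified
  -- by every nontrivial congruence (the monolith is nontrivial); in
  -- particular A has at least two elements.
  SubdirectlyIrreducible : Set₁
  SubdirectlyIrreducible =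
    Σ Carrier λ a → Σ Carrier λ b → ¬ (a ≈ b) ×
      (∀ (c : Congruence) → NontrivialCong c → Congruence.θ c a b)

  record PrimeFilter : Set₁ where
    field
      F       : Carrier → Set
      upward  : ∀ {x y} → x ≤ y → F x → F y
      has-⊤   : F ⊤
      closed-∧ : ∀ {x y} → F x → F y → F (x ∧ y)
      proper  : ¬ F ⊥
      prime   : ∀ {x y} → F (x ∨ y) → F x ⊎ F y

  _⊆F_ : PrimeFilter → PrimeFilter → Set
  P ⊆F Q = ∀ x → PrimeFilter.F P x → PrimeFilter.F Q x

  WidthAtMost : ℕ → Set₁
  WidthAtMost n = ∀ (P : PrimeFilter) (Q : Fin (suc n) → PrimeFilter) →
    (∀ i → P ⊆F Q i) → ¬ (∀ i j → ¬ (i ≡ j) → ¬ (Q i ⊆F Q j))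

record Hom (A B : HA) : Set where
  module A = HeytingAlgebra A
  module B = HeytingAlgebra B
  field
    f     : A.Carrier → B.Carrier
    cong  : ∀ {x y} → x A.≈ y → f x B.≈ f y
    pres-∧ : ∀ x y → f (x A.∧ y) B.≈ (f x B.∧ f y)
    pres-∨ : ∀ x y → f (x A.∨ y) B.≈ (f x B.∨ f y)
    pres-⇨ : ∀ x y → f (x A.⇨ y) B.≈ (f x B.⇨ f y)
    pres-⊤ : f A.⊤ B.≈ B.⊤
    pres-⊥ : f A.⊥ B.≈ B.⊥

Surjective : ∀ {A B} → Hom A B → Set
Surjective {A} {B} h = ∀ b → Σ (HeytingAlgebra.Carrier A) λ a →
  HeytingAlgebra._≈_ B (Hom.f h a) b

record FinPoset : Set where
  field
    size    : ℕ
    _≤ᵇ_    : Fin size → Fin size → Bool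
    ≤-refl  : ∀ x → T (x ≤ᵇ x)
    ≤-trans : ∀ {x y z} → T (x ≤ᵇ y) → T (y ≤ᵇ z) → T (x ≤ᵇ z)
    ≤-antisym : ∀ {x y} → T (x ≤ᵇ y) → T (y ≤ᵇ x) → x ≡ y

module _ (P : FinPoset) where
  open FinPoset P

  record Upset : Set where
    field
      mem : Fin size → Bool
      up  : ∀ {x y} → T (x ≤ᵇ y) → T (mem x) → T (mem y)
  open Upset

  _≐_ : Upset → Upset → Set
  U ≐ V = ∀ x → mem U x ≡ mem V x

  Up-⊤ : Upset
  Up-⊤ = record { mem = λ _ → true ; up = λ _ _ → _ }

  Up-⊥ : Upset
  Up-⊥ = record { mem = λ _ → false ; up = λ _ () }

  Up-∧ : Upset → Upset → Upset
  Up-∧ U V = record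
    { mem = λ x → mem U x ∧ᵇ mem V x
    ; up  = λ x≤y h → let (a , b) = Equivalence.to T-∧ h in
              Equivalence.from T-∧ (up U x≤y a , up V x≤y b) }

  Up-∨ : Upset → Upset → Upset
  Up-∨ U V = record
    { mem = λ x → mem U x ∨ᵇ mem V x
    ; up  = λ x≤y h → Equivalence.from T-∨ (Data.Sum.map (up U x≤y) (up V x≤y)
                                              (Equivalence.to T-∨ h)) }
    where import Data.Sum

  Up-⇨ : Upset → Upset → Upset
  Up-⇨ U V = record
    { mem = λ x → isYes (dec x)
    ; up  = λ {x} {x′} x≤x′ h → fromWitness {a? = dec x′}
              (λ y x′≤y → toWitness {a? = dec x} h y (≤-trans x≤x′ x′≤y)) }
    where
    dec : ∀ x → Dec (∀ y → T (x ≤ᵇ y) → T (mem U y) → T (mem V y))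
    dec x = all? (λ y → T? (x ≤ᵇ y) →-dec (T? (mem U y) →-dec T? (mem V y)))

  record UpEmbedding (B : HA) : Set where
    open HeytingAlgebra B
    field
      e      : Upset → Carrier
      cong   : ∀ {U V} → U ≐ V → e U ≈ e V
      pres-∧ : ∀ U V → e (Up-∧ U V) ≈ (e U ∧ e V)
      pres-∨ : ∀ U V → e (Up-∨ U V) ≈ (e U ∨ e V)
      pres-⇨ : ∀ U V → e (Up-⇨ U V) ≈ (e U ⇨ e V)
      pres-⊤ : e Up-⊤ ≈ ⊤
      pres-⊥ : e Up-⊥ ≈ ⊥
      injective : ∀ U V → e U ≈ e V → U ≐ V

-- A refutes the Jankov formula J(P) = J(Up(P)):  by the defining property
-- of Jankov formulas, iff Up(P) is isomorphic to a subalgebra of a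
-- homomorphic image of A, i.e. there is a surjective homomorphism A → B
-- and an embedding Up(P) ↪ B.
RefutesJankov : HA → FinPoset → Set₁
RefutesJankov A P = Σ HA λ B → Σ (Hom A B) λ h → Surjective h × UpEmbedding P B

-- F_m on Fin (suc m): zero is the root, suc i (i : Fin m) are the m
-- pairwise incomparable elements above it.
F-≤ᵇ : ∀ {m} → Fin (suc m) → Fin (suc m) → Bool
F-≤ᵇ zero    _       = true
F-≤ᵇ (suc i) zero    = false
F-≤ᵇ (suc i) (suc j) = isYes (i ≟ j)

-- D_m on Fin (suc (suc m)): zero is the bottom, suc zero the top, and
-- suc (suc i) (i : Fin m) the m pairwise incomparable middle elements.
D-≤ᵇ : ∀ {m} → Fin (suc (suc m)) → Fin (suc (suc m)) → Bool
D-≤ᵇ zero          _             = true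
D-≤ᵇ (suc zero)    zero          = false
D-≤ᵇ (suc zero)    (suc zero)    = true
D-≤ᵇ (suc zero)    (suc (suc j)) = false
D-≤ᵇ (suc (suc i)) zero          = false
D-≤ᵇ (suc (suc i)) (suc zero)    = true
D-≤ᵇ (suc (suc i)) (suc (suc j)) = isYes (i ≟ j)

F-refl : ∀ {m} (x : Fin (suc m)) → T (F-≤ᵇ x x)
F-refl zero    = _
F-refl (suc i) = fromWitness {a? = i ≟ i} refl

F-trans : ∀ {m} {x y z : Fin (suc m)} → T (F-≤ᵇ x y) → T (F-≤ᵇ y z) → T (F-≤ᵇ x z)
F-trans {x = zero} _ _ = _
F-trans {x = suc i} {zero} ()
F-trans {x = suc i} {suc j} {zero} _ ()
F-trans {x = suc i} {suc j} {suc k} p q =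
  fromWitness {a? = i ≟ k} (≡-trans (toWitness {a? = i ≟ j} p) (toWitness {a? = j ≟ k} q))

F-antisym : ∀ {m} {x y : Fin (suc m)} → T (F-≤ᵇ x y) → T (F-≤ᵇ y x) → x ≡ y
F-antisym {x = zero} {zero} _ _ = refl
F-antisym {x = zero} {suc j} _ ()
F-antisym {x = suc i} {zero} ()
F-antisym {x = suc i} {suc j} p _ = ≡-cong suc (toWitness {a? = i ≟ j} p)

F : ℕ → FinPoset
F m = record
  { size = suc m ; _≤ᵇ_ = F-≤ᵇ ; ≤-refl = F-refl ; ≤-trans = λ {x} {y} {z} → F-trans {x = x} {y} {z}
  ; ≤-antisym = F-antisym }

D-refl : ∀ {m} (x : Fin (suc (suc m))) → T (D-≤ᵇ x x)
D-refl zero          = _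
D-refl (suc zero)    = _
D-refl (suc (suc i)) = fromWitness {a? = i ≟ i} refl

D-trans : ∀ {m} {x y z : Fin (suc (suc m))} →
          T (D-≤ᵇ x y) → T (D-≤ᵇ y z) → T (D-≤ᵇ x z)
D-trans {x = zero} _ _ = _
D-trans {x = suc zero} {zero} ()
D-trans {x = suc zero} {suc zero} {zero} _ ()
D-trans {x = suc zero} {suc zero} {suc zero} _ _ = _
D-trans {x = suc zero} {suc zero} {suc (suc k)} _ ()
D-trans {x = suc zero} {suc (suc j)} ()
D-trans {x = suc (suc i)} {zero} ()
D-trans {x = suc (suc i)} {suc zero} {zero} _ ()
D-trans {x = suc (suc i)} {suc zero} {suc zero} _ _ = _
D-trans {x = suc (suc i)} {suc zero} {suc (suc k)} _ ()
D-trans {x = suc (suc i)} {suc (suc j)} {zero} _ ()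
D-trans {x = suc (suc i)} {suc (suc j)} {suc zero} _ _ = _
D-trans {x = suc (suc i)} {suc (suc j)} {suc (suc k)} p q =
  fromWitness {a? = i ≟ k} (≡-trans (toWitness {a? = i ≟ j} p) (toWitness {a? = j ≟ k} q))

D-antisym : ∀ {m} {x y : Fin (suc (suc m))} → T (D-≤ᵇ x y) → T (D-≤ᵇ y x) → x ≡ y
D-antisym {x = zero} {zero} _ _ = refl
D-antisym {x = zero} {suc zero} _ ()
D-antisym {x = zero} {suc (suc j)} _ ()
D-antisym {x = suc zero} {zero} ()
D-antisym {x = suc zero} {suc zero} _ _ = refl
D-antisym {x = suc zero} {suc (suc j)} ()
D-antisym {x = suc (suc i)} {zero} ()
D-antisym {x = suc (suc i)} {suc zero} _ ()
D-antisym {x = suc (suc i)} {suc (suc j)} p _ = ≡-cong (λ k → suc (suc k)) (toWitness {a? = i ≟ j} p)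

D : ℕ → FinPoset
D m = record
  { size = suc (suc m) ; _≤ᵇ_ = D-≤ᵇ ; ≤-refl = D-refl ; ≤-trans = λ {x} {y} {z} → D-trans {x = x} {y} {z}
  ; ≤-antisym = D-antisym }

-- Taking least elements of prime filters, the failure of width ≤ n yields a join-prime a and n + 1
-- pairwise incomparable join-primes q i below it, with a minimal among join-primes above all q i.
-- The weak Peirce law makes any join-prime strictly below some q i lie below every q j, so that
-- t = q 0 ∧ q 1 is the meet of any two of the q i, and any join-prime between some q k and a equals
-- q k or a. In the image of A below a, the elements d 0 = X ⇨ t, with X = q 1 ∨ … ∨ q n, and
-- d (i + 1) = q (i + 1) then behave like n + 1 independent atoms over t: the joins t ∨ ⋁_{i ∈ S} d i
-- form a copy of the powerset of Fin (n + 1) with pointwise implication, strictly below ⊤.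
-- Adding ⊤ gives Up (F (n + 1)) when t = ⊥; when t ≠ ⊥ one has ¬ t = ⊥ below a, and adding ⊥
-- as well gives Up (D (n + 1)).

module Submission where

open import Data.Bool using (Bool; true; false; T; if_then_else_)
open import Data.Bool.Properties using (T-∧; T-∨)
open import Data.Empty using (⊥-elim)
open import Data.Fin using (Fin; zero; suc; _≟_)
open import Data.Fin.Induction using (po-wellFounded)
open import Data.Fin.Properties using (all?; any?; ¬∀⟶∃¬; suc-injective)
open import Data.Nat using (ℕ; zero; suc)
open import Data.Product using (∃; _×_; _,_; proj₁; proj₂)
open import Data.Sum using (_⊎_; inj₁; inj₂; [_,_]; [_,_]′; swap) renaming (map to map-⊎)
open import Data.Vec using (Vec; []; _∷_; lookup; tabulate)
open import Data.Vec.Functional using (foldr)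
open import Data.Vec.Properties using (lookup∘tabulate)
open import Function using (_∘_; case_of_)
open import Function.Bundles using (Equivalence)
open import Induction.WellFounded using (WellFounded; Acc; acc; module Subrelation)
import Relation.Binary.Construct.On as On
open import Relation.Binary.Lattice.Bundles using (HeytingAlgebra)
open import Relation.Binary.PropositionalEquality using (_≡_; _≢_; refl; sym; cong; subst)
open import Relation.Nullary using (¬_; Dec; yes; no; isYes)
open import Relation.Nullary.Decidable
  using (¬¬-excluded-middle; T?; map′; ¬?; _×-dec_; _→-dec_; toWitness; fromWitness)

open import Defs

module HeytingLemmas (B : HA) where
  open HeytingAlgebra B public
    renaming (refl to ≤-refl; trans to ≤-trans; antisym to ≤-antisym; reflexive to ≤-reflexive)
  open import Relation.Binary.Lattice.Properties.HeytingAlgebra B public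
    using (y≤x⇨y; ⇨-applyʳ; ⇨-relax; swap-transpose-⇨; ∧-distribˡ-∨-≤)
  open import Relation.Binary.Lattice.Properties.MeetSemilattice meetSemilattice public
    using (∧-monotonic; ∧-assoc; ≈-dec⇒≤-dec)
  open import Relation.Binary.Lattice.Properties.JoinSemilattice joinSemilattice public
    using (∨-monotonic)

  ≤-⊤ : ∀ {x} → x ≤ ⊤
  ≤-⊤ = maximum _

  ⊥-≤ : ∀ {x} → ⊥ ≤ x
  ⊥-≤ = minimum _

  ∧-comm-≤ : ∀ {x y} → x ∧ y ≤ y ∧ x
  ∧-comm-≤ = ∧-greatest (x∧y≤y _ _) (x∧y≤x _ _)

  swap-transpose-∧ : ∀ {w x z} → x ≤ w ⇨ z → w ∧ x ≤ z
  swap-transpose-∧ x≤w⇨z = ≤-trans ∧-comm-≤ (transpose-∧ x≤w⇨z)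

  modus-ponens : ∀ {w x y} → w ≤ x → w ≤ x ⇨ y → w ≤ y
  modus-ponens w≤x w≤x⇨y = ≤-trans (∧-greatest w≤x⇨y w≤x) (transpose-∧ ≤-refl)

  ⊤⇨-≤ : ∀ {x} → ⊤ ⇨ x ≤ x
  ⊤⇨-≤ = modus-ponens ≤-⊤ ≤-refl

  ∧-∨-least : ∀ {w x y z} → w ∧ x ≤ z → w ∧ y ≤ z → w ∧ (x ∨ y) ≤ z
  ∧-∨-least w∧x≤z w∧y≤z = ≤-trans (∧-distribˡ-∨-≤ _ _ _) (∨-least w∧x≤z w∧y≤z)

  ⋁ : ∀ {m} → (Fin m → Carrier) → Carrier
  ⋁ = foldr _∨_ ⊥

  ⋁-upper : ∀ {m} (f : Fin m → Carrier) i → f i ≤ ⋁ f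
  ⋁-upper f zero    = x≤x∨y _ _
  ⋁-upper f (suc i) = ≤-trans (⋁-upper (λ j → f (suc j)) i) (y≤x∨y _ _)

  ⋁-least : ∀ {m} (f : Fin m → Carrier) {z} → (∀ i → f i ≤ z) → ⋁ f ≤ z
  ⋁-least {zero}  f _ = ⊥-≤
  ⋁-least {suc m} f h = ∨-least (h zero) (⋁-least (λ j → f (suc j)) (λ j → h (suc j)))

  ∧-⋁-least : ∀ {m w z} (f : Fin m → Carrier) → (∀ i → w ∧ f i ≤ z) → w ∧ ⋁ f ≤ z
  ∧-⋁-least {zero}  f _ = ≤-trans (x∧y≤y _ _) ⊥-≤
  ∧-⋁-least {suc m} f h = ∧-∨-least (h zero) (∧-⋁-least (λ j → f (suc j)) (λ j → h (suc j)))

  record JoinPrime (u : Carrier) : Set where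
    field
      nonzero : ¬ u ≤ ⊥
      prime   : ∀ {x y} → u ≤ x ∨ y → u ≤ x ⊎ u ≤ y

  JoinPrime-resp-≈ : ∀ {u v} → u ≈ v → JoinPrime u → JoinPrime v
  JoinPrime-resp-≈ u≈v jp = record
    { nonzero = λ v≤⊥ → nonzero (≤-trans (≤-reflexive u≈v) v≤⊥)
    ; prime   = λ v≤x∨y → map-⊎ (≤-trans v≤u) (≤-trans v≤u) (prime (≤-trans (≤-reflexive u≈v) v≤x∨y))
    }
    where
    open JoinPrime jp
    v≤u = ≤-reflexive (Eq.sym u≈v)

  JoinPrime-⋁ : ∀ {u m} → JoinPrime u → (f : Fin m → Carrier) → u ≤ ⋁ f → ∃ λ i → u ≤ f i
  JoinPrime-⋁ {m = zero}  jp f u≤⊥ = ⊥-elim (JoinPrime.nonzero jp u≤⊥)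
  JoinPrime-⋁ {m = suc m} jp f u≤⋁ with JoinPrime.prime jp u≤⋁
  ... | inj₁ u≤f0 = zero , u≤f0
  ... | inj₂ u≤⋁′ = let i , u≤fi = JoinPrime-⋁ jp (λ j → f (suc j)) u≤⋁′ in suc i , u≤fi

  upper : Bool → Carrier → Carrier
  upper true  _ = ⊤
  upper false x = x

  ≤-upper : ∀ b {x} → x ≤ upper b x
  ≤-upper true  = ≤-⊤
  ≤-upper false = ≤-refl

  ⊤≤upper : ∀ b {x} → T b → ⊤ ≤ upper b x
  ⊤≤upper true _ = ≤-refl

  upper≤ : ∀ b {x} → ¬ T b → upper b x ≤ x
  upper≤ true  ¬b = ⊥-elim (¬b _)
  upper≤ false _  = ≤-refl

  lower : Bool → Carrier → Carrier
  lower true  x = x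
  lower false _ = ⊥

  lower≤ : ∀ b {x} → lower b x ≤ x
  lower≤ true  = ≤-refl
  lower≤ false = ⊥-≤

  ≤lower : ∀ b {x} → T b → x ≤ lower b x
  ≤lower true _ = ≤-refl

  lower≤⊥ : ∀ b {x} → ¬ T b → lower b x ≤ ⊥
  lower≤⊥ true  ¬b = ⊥-elim (¬b _)
  lower≤⊥ false _  = ≤-refl

T-ext : ∀ {a b} → (T a → T b) → (T b → T a) → a ≡ b
T-ext {false} {false} _ _ = refl
T-ext {false} {true}  _ g = ⊥-elim (g _)
T-ext {true}  {false} f _ = ⊥-elim (f _)
T-ext {true}  {true}  _ _ = refl

¬[T⇒T] : ∀ {a b} → ¬ (T a → T b) → T a × ¬ T b
¬[T⇒T] {true}  ¬a⇒b = _ , λ b → ¬a⇒b (λ _ → b)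
¬[T⇒T] {false} ¬a⇒b = ⊥-elim (¬a⇒b (λ ()))

module UpsetLemmas (P : FinPoset) where
  open FinPoset P using (_≤ᵇ_) renaming (≤-refl to ≤ᵇ-refl)
  open Upset public

  infix 4 _⊆_
  _⊆_ : Upset P → Upset P → Set
  U ⊆ V = ∀ x → T (mem U x) → T (mem V x)

  ≐⇒⊆ : ∀ {U V} → _≐_ P U V → U ⊆ V
  ≐⇒⊆ U≐V x = subst T (U≐V x)

  ⊆-antisym : ∀ {U V} → U ⊆ V → V ⊆ U → _≐_ P U V
  ⊆-antisym U⊆V V⊆U x = T-ext (U⊆V x) (V⊆U x)

  ∩-⊆ˡ : ∀ U V → Up-∧ P U V ⊆ U
  ∩-⊆ˡ U V x h = proj₁ (Equivalence.to T-∧ h)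

  ∩-⊆ʳ : ∀ U V → Up-∧ P U V ⊆ V
  ∩-⊆ʳ U V x h = proj₂ (Equivalence.to T-∧ h)

  ⊆-∩ : ∀ W U V → W ⊆ U → W ⊆ V → W ⊆ Up-∧ P U V
  ⊆-∩ W U V W⊆U W⊆V x h = Equivalence.from T-∧ (W⊆U x h , W⊆V x h)

  ⊆-∪ˡ : ∀ U V → U ⊆ Up-∨ P U V
  ⊆-∪ˡ U V x h = Equivalence.from T-∨ (inj₁ h)

  ⊆-∪ʳ : ∀ U V → V ⊆ Up-∨ P U V
  ⊆-∪ʳ U V x h = Equivalence.from T-∨ (inj₂ h)

  ∪-mem : ∀ U V x → T (mem (Up-∨ P U V) x) → T (mem U x) ⊎ T (mem V x)
  ∪-mem U V x = Equivalence.to T-∨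

  ⇨-mem : ∀ U V x → T (mem (Up-⇨ P U V) x) → ∀ y → T (x ≤ᵇ y) → T (mem U y) → T (mem V y)
  ⇨-mem U V x = toWitness {a? = all? (λ y → T? (x ≤ᵇ y) →-dec (T? (mem U y) →-dec T? (mem V y)))}

  mem-⇨ : ∀ U V x → (∀ y → T (x ≤ᵇ y) → T (mem U y) → T (mem V y)) → T (mem (Up-⇨ P U V) x)
  mem-⇨ U V x = fromWitness {a? = all? (λ y → T? (x ≤ᵇ y) →-dec (T? (mem U y) →-dec T? (mem V y)))}

  ⊆-⇨ : ∀ U V → V ⊆ Up-⇨ P U V
  ⊆-⇨ U V x h = mem-⇨ U V x (λ y x≤y _ → up V x≤y h)

  ⇨-∩-⊆ : ∀ U V → Up-∧ P (Up-⇨ P U V) U ⊆ V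
  ⇨-∩-⊆ U V x h = ⇨-mem U V x (∩-⊆ˡ R U x h) x (≤ᵇ-refl x) (∩-⊆ʳ R U x h)
    where R = Up-⇨ P U V

  ⊆⇒⇨-full : ∀ U V → U ⊆ V → ∀ x → T (mem (Up-⇨ P U V) x)
  ⊆⇒⇨-full U V U⊆V x = mem-⇨ U V x (λ y _ → U⊆V y)

  -- Monotonicity gives one inequality of each Heyting law (for ⇨ together with meet), so an order
  -- embedding needs only the other one.
  record UpOrderEmbedding (B : HA) : Set where
    open HeytingLemmas B
    field
      e        : Upset P → Carrier
      monotone : ∀ U V → U ⊆ V → e U ≤ e V
      reflects : ∀ U V → e U ≤ e V → U ⊆ V
      meet     : ∀ U V → e U ∧ e V ≤ e (Up-∧ P U V)
      join     : ∀ U V → e (Up-∨ P U V) ≤ e U ∨ e V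
      impl     : ∀ U V → e U ⇨ e V ≤ e (Up-⇨ P U V)
      top      : ⊤ ≤ e (Up-⊤ P)
      bottom   : e (Up-⊥ P) ≤ ⊥

    upEmbedding : UpEmbedding P B
    upEmbedding = record
      { e         = e
      ; cong      = λ {U} {V} U≐V → ≤-antisym (monotone U V (≐⇒⊆ {U} {V} U≐V))
                                              (monotone V U (≐⇒⊆ {V} {U} (λ x → sym (U≐V x))))
      ; pres-∧    = λ U V → ≤-antisym
                      (∧-greatest (monotone _ U (∩-⊆ˡ U V)) (monotone _ V (∩-⊆ʳ U V))) (meet U V)
      ; pres-∨    = λ U V → ≤-antisym
                      (join U V) (∨-least (monotone U _ (⊆-∪ˡ U V)) (monotone V _ (⊆-∪ʳ U V)))
      ; pres-⇨    = λ U V → ≤-antisym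
                      (transpose-⇨ (≤-trans (meet (Up-⇨ P U V) U) (monotone _ V (⇨-∩-⊆ U V)))) (impl U V)
      ; pres-⊤    = ≤-antisym ≤-⊤ top
      ; pres-⊥    = ≤-antisym bottom ⊥-≤
      ; injective = λ U V eU≈eV → ⊆-antisym {U} {V} (reflects U V (≤-reflexive eU≈eV))
                                                      (reflects V U (≤-reflexive (Eq.sym eU≈eV)))
      }

-- Inside B, base and the points carve out a copy of the powerset of Fin m: the
-- elements span S = base ∨ ⋁_{i ∈ S} point i, with ⇨ computed pointwise.
module _ (B : HA) where
  open HeytingLemmas B

  record Span (m : ℕ) : Set where
    field
      base              : Carrier
      point             : Fin m → Carrier
      base≤point        : ∀ i → base ≤ point i
      point∧point≤base  : ∀ {i j} → i ≢ j → point i ∧ point j ≤ base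
      point⇨base-least  : ∀ i {z} → base ≤ z → (∀ j → j ≢ i → point j ≤ z) → point i ⇨ base ≤ z
      point≰base        : ∀ i → ¬ point i ≤ base
      ⊤≰base∨⋁point     : ¬ ⊤ ≤ base ∨ ⋁ point

module SpanLemmas {B : HA} {m : ℕ} (S : Span B m) where
  open HeytingLemmas B
  open Span S

  Selection : Set
  Selection = Fin m → Bool

  span : Selection → Carrier
  span f = base ∨ ⋁ (λ i → if f i then point i else ⊥)

  base≤span : ∀ f → base ≤ span f
  base≤span f = x≤x∨y _ _

  point≤span : ∀ f {i} → T (f i) → point i ≤ span f
  point≤span f {i} fi = ≤-trans (selected fi) (≤-trans (⋁-upper _ i) (y≤x∨y _ _))
    where
    selected : ∀ {b} → T b → point i ≤ (if b then point i else ⊥)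
    selected {true} _ = ≤-refl

  span-least : ∀ f {z} → base ≤ z → (∀ i → T (f i) → point i ≤ z) → span f ≤ z
  span-least f base≤z point≤z = ∨-least base≤z (⋁-least _ (λ i → selected (point≤z i)))
    where
    selected : ∀ {b i z} → (T b → point i ≤ z) → (if b then point i else ⊥) ≤ z
    selected {true}  h = h _
    selected {false} _ = ⊥-≤

  ∧-span-least : ∀ f {w z} → w ∧ base ≤ z → (∀ i → T (f i) → w ∧ point i ≤ z) → w ∧ span f ≤ z
  ∧-span-least f base≤z point≤z =
    swap-transpose-∧ (span-least f (swap-transpose-⇨ base≤z) (λ i fi → swap-transpose-⇨ (point≤z i fi)))

  span-mono : ∀ f g → (∀ i → T (f i) → T (g i)) → span f ≤ span g
  span-mono f g f⊆g = span-least f (base≤span g) (λ i fi → point≤span g (f⊆g i fi))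

  point∧span≤base : ∀ f {k} → ¬ T (f k) → point k ∧ span f ≤ base
  point∧span≤base f {k} k∉f = ∧-span-least f (x∧y≤y _ _) (λ i fi → meet i fi (i ≟ k))
    where
    meet : ∀ i → T (f i) → Dec (i ≡ k) → point k ∧ point i ≤ base
    meet i fi (yes refl) = ⊥-elim (k∉f fi)
    meet i fi (no i≢k)   = point∧point≤base (λ k≡i → i≢k (sym k≡i))

  span-∧ : ∀ f g h → (∀ i → T (f i) → T (g i) → T (h i)) → span f ∧ span g ≤ span h
  span-∧ f g h f∩g⊆h = ∧-span-least g (≤-trans (x∧y≤y _ _) (base≤span h)) λ j gj →
    ≤-trans ∧-comm-≤ (∧-span-least f (≤-trans (x∧y≤y _ _) (base≤span h)) λ i fi → meet i j fi gj (i ≟ j))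
    where
    meet : ∀ i j → T (f i) → T (g j) → Dec (i ≡ j) → point j ∧ point i ≤ span h
    meet i j fi gj (yes refl) = ≤-trans (x∧y≤x _ _) (point≤span h (f∩g⊆h i fi gj))
    meet i j fi gj (no i≢j)   = ≤-trans (point∧point≤base (λ j≡i → i≢j (sym j≡i))) (base≤span h)

  span-∨ : ∀ f g h → (∀ i → T (h i) → T (f i) ⊎ T (g i)) → span h ≤ span f ∨ span g
  span-∨ f g h h⊆f∪g = span-least h (≤-trans (base≤span f) (x≤x∨y _ _)) (λ i hi →
    [ (λ fi → ≤-trans (point≤span f fi) (x≤x∨y _ _))
    , (λ gi → ≤-trans (point≤span g gi) (y≤x∨y _ _)) ] (h⊆f∪g i hi))

  span-⇨ : ∀ f g h {k} → T (f k) → ¬ T (g k) → (∀ i → (T (f i) → T (g i)) → T (h i)) →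
           span f ⇨ span g ≤ span h
  span-⇨ f g h {k} fk ¬gk f⇒g⊆h = modus-ponens ≤-refl (≤-trans z≤point⇨base point⇨base≤z⇨span)
    where
    z = span f ⇨ span g

    point∧z≤span : ∀ {j} → T (f j) → point j ∧ z ≤ span g
    point∧z≤span fj = ⇨-applyʳ (point≤span f fj)

    z≤point⇨base : z ≤ point k ⇨ base
    z≤point⇨base = swap-transpose-⇨ (≤-trans (∧-greatest (x∧y≤x _ _) (point∧z≤span fk)) (point∧span≤base g ¬gk))

    z∧point≤span : ∀ j → Dec (T (g j)) → Dec (T (f j)) → z ∧ point j ≤ span h
    z∧point≤span j (yes gj) _        = ≤-trans (x∧y≤y _ _) (point≤span h (f⇒g⊆h j (λ _ → gj)))
    z∧point≤span j (no ¬gj) (no ¬fj) = ≤-trans (x∧y≤y _ _) (point≤span h (f⇒g⊆h j (λ fj → ⊥-elim (¬fj fj))))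
    z∧point≤span j (no ¬gj) (yes fj) =
      ≤-trans (∧-greatest (x∧y≤y _ _) (≤-trans ∧-comm-≤ (point∧z≤span fj)))
              (≤-trans (point∧span≤base g ¬gj) (base≤span h))

    point⇨base≤z⇨span : point k ⇨ base ≤ z ⇨ span h
    point⇨base≤z⇨span = point⇨base-least k (≤-trans (base≤span h) y≤x⇨y)
      (λ j _ → swap-transpose-⇨ (z∧point≤span j (T? (g j)) (T? (f j))))

  span-reflects : ∀ f g → span f ≤ span g → ∀ i → T (f i) → T (g i)
  span-reflects f g f≤g i fi with T? (g i)
  ... | yes gi = gi
  ... | no ¬gi = ⊥-elim (point≰base i
        (≤-trans (∧-greatest ≤-refl (≤-trans (point≤span f fi) f≤g)) (point∧span≤base g ¬gi)))

  ⊤≰span : ∀ f → ¬ ⊤ ≤ span f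
  ⊤≰span f ⊤≤f = ⊤≰base∨⋁point (≤-trans ⊤≤f (span-mono f (λ _ → true) (λ _ _ → _)))

module FanEmbedding {B : HA} {m : ℕ} (S : Span B m)
                    (base≤⊥ : HeytingAlgebra._≤_ B (Span.base S) (HeytingAlgebra.⊥ B)) where
  open HeytingLemmas B
  open SpanLemmas S
  open UpsetLemmas (F m)

  leaves : Upset (F m) → Selection
  leaves U i = mem U (suc i)

  embed : Upset (F m) → Carrier
  embed U = upper (mem U zero) (span (leaves U))

  ⊤≤embed : ∀ U → T (mem U zero) → ⊤ ≤ embed U
  ⊤≤embed U = ⊤≤upper (mem U zero)

  embed≤span : ∀ U → ¬ T (mem U zero) → embed U ≤ span (leaves U)
  embed≤span U = upper≤ (mem U zero)

  span≤embed : ∀ U → span (leaves U) ≤ embed U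
  span≤embed U = ≤-upper (mem U zero)

  root-full : ∀ (U : Upset (F m)) → T (mem U zero) → ∀ x → T (mem U x)
  root-full U root x = up U {zero} {x} _ root

  leaf-maximal : ∀ {i : Fin m} y → T (F-≤ᵇ (suc i) y) → suc i ≡ y
  leaf-maximal zero    ()
  leaf-maximal (suc j) i≡j = cong suc (toWitness {a? = _ ≟ j} i≡j)

  monotone : ∀ U V → U ⊆ V → embed U ≤ embed V
  monotone U V U⊆V with T? (mem V zero)
  ... | yes v0 = ≤-trans ≤-⊤ (⊤≤embed V v0)
  ... | no ¬v0 = ≤-trans (embed≤span U (λ u0 → ¬v0 (U⊆V zero u0)))
                 (≤-trans (span-mono _ _ (λ i → U⊆V (suc i))) (span≤embed V))

  reflects : ∀ U V → embed U ≤ embed V → U ⊆ V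
  reflects U V U≤V x ux with T? (mem V zero) | T? (mem U zero)
  ... | yes v0 | _      = root-full V v0 x
  ... | no ¬v0 | yes u0 = ⊥-elim (⊤≰span (leaves V) (≤-trans (⊤≤embed U u0) (≤-trans U≤V (embed≤span V ¬v0))))
  ... | no ¬v0 | no ¬u0 = leafwise x ux
    where
    leafwise : U ⊆ V
    leafwise zero    u0 = ⊥-elim (¬u0 u0)
    leafwise (suc i) ui = span-reflects (leaves U) (leaves V)
      (≤-trans (span≤embed U) (≤-trans U≤V (embed≤span V ¬v0))) i ui

  meet : ∀ U V → embed U ∧ embed V ≤ embed (Up-∧ (F m) U V)
  meet U V with T? (mem U zero) | T? (mem V zero)
  ... | yes u0 | _      = ≤-trans (x∧y≤y _ _) (monotone V W (⊆-∩ V U V (λ x _ → root-full U u0 x) (λ _ v → v)))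
    where W = Up-∧ (F m) U V
  ... | no _   | yes v0 = ≤-trans (x∧y≤x _ _) (monotone U W (⊆-∩ U U V (λ _ u → u) (λ x _ → root-full V v0 x)))
    where W = Up-∧ (F m) U V
  ... | no ¬u0 | no ¬v0 =
    ≤-trans (∧-monotonic (embed≤span U ¬u0) (embed≤span V ¬v0))
    (≤-trans (span-∧ (leaves U) (leaves V) (leaves W) (λ _ u v → Equivalence.from T-∧ (u , v))) (span≤embed W))
    where W = Up-∧ (F m) U V

  join : ∀ U V → embed (Up-∨ (F m) U V) ≤ embed U ∨ embed V
  join U V with T? (mem U zero) | T? (mem V zero)
  ... | yes u0 | _      = ≤-trans ≤-⊤ (≤-trans (⊤≤embed U u0) (x≤x∨y _ _))
  ... | no _   | yes v0 = ≤-trans ≤-⊤ (≤-trans (⊤≤embed V v0) (y≤x∨y _ _))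
  ... | no ¬u0 | no ¬v0 =
    ≤-trans (embed≤span W ([ ¬u0 , ¬v0 ] ∘ ∪-mem U V zero))
    (≤-trans (span-∨ (leaves U) (leaves V) (leaves W) (λ i → ∪-mem U V (suc i)))
             (∨-monotonic (span≤embed U) (span≤embed V)))
    where W = Up-∨ (F m) U V

  impl : ∀ U V → embed U ⇨ embed V ≤ embed (Up-⇨ (F m) U V)
  impl U V = by-cases (T? (mem U zero)) (T? (mem V zero))
                      (all? (λ i → T? (leaves U i) →-dec T? (leaves V i)))
    where
    R = Up-⇨ (F m) U V

    by-cases : Dec (T (mem U zero)) → Dec (T (mem V zero)) → Dec (∀ i → T (leaves U i) → T (leaves V i)) →
               embed U ⇨ embed V ≤ embed R
    by-cases (yes u0) _ _ = ≤-trans (⇨-relax (⊤≤embed U u0) ≤-refl) (≤-trans ⊤⇨-≤ (monotone V R (⊆-⇨ U V)))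
    by-cases (no _) (yes v0) _ = ≤-trans ≤-⊤ (⊤≤embed R (⊆-⇨ U V zero v0))
    by-cases (no ¬u0) (no _) (yes leaves⊆) = ≤-trans ≤-⊤ (⊤≤embed R (⊆⇒⇨-full U V U⊆V zero))
      where
      U⊆V : U ⊆ V
      U⊆V zero    u0 = ⊥-elim (¬u0 u0)
      U⊆V (suc i) ui = leaves⊆ i ui
    by-cases (no ¬u0) (no ¬v0) (no ¬leaves⊆) =
      let k , ¬[Uk⇒Vk] = ¬∀⟶∃¬ m _ (λ i → T? (leaves U i) →-dec T? (leaves V i)) ¬leaves⊆
          Uk , ¬Vk = ¬[T⇒T] ¬[Uk⇒Vk]
      in ≤-trans (⇨-relax (span≤embed U) (embed≤span V ¬v0))
         (≤-trans (span-⇨ (leaves U) (leaves V) (leaves R) Uk ¬Vk leafwise) (span≤embed R))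
      where
      leafwise : ∀ i → (T (leaves U i) → T (leaves V i)) → T (leaves R i)
      leafwise i Ui⇒Vi = mem-⇨ U V (suc i) λ y i≤y → case leaf-maximal y i≤y of λ where
        refl → Ui⇒Vi

  upEmbedding : UpEmbedding (F m) B
  upEmbedding = UpOrderEmbedding.upEmbedding record
    { e        = embed
    ; monotone = monotone
    ; reflects = reflects
    ; meet     = meet
    ; join     = join
    ; impl     = impl
    ; top      = ≤-refl
    ; bottom   = span-least _ base≤⊥ (λ _ ())
    }

module DiamondEmbedding {B : HA} {m : ℕ} (S : Span B m)
  (base≰⊥ : ¬ HeytingAlgebra._≤_ B (Span.base S) (HeytingAlgebra.⊥ B))
  (¬base≤⊥ : HeytingAlgebra._≤_ B (HeytingAlgebra._⇨_ B (Span.base S) (HeytingAlgebra.⊥ B)) (HeytingAlgebra.⊥ B))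
  where
  open HeytingLemmas B
  open SpanLemmas S
  open UpsetLemmas (D m)

  middles : Upset (D m) → Selection
  middles U i = mem U (suc (suc i))

  embed : Upset (D m) → Carrier
  embed U = upper (mem U zero) (lower (mem U (suc zero)) (span (middles U)))

  ⊤≤embed : ∀ U → T (mem U zero) → ⊤ ≤ embed U
  ⊤≤embed U = ⊤≤upper (mem U zero)

  embed≤span : ∀ U → ¬ T (mem U zero) → embed U ≤ span (middles U)
  embed≤span U ¬bottom = ≤-trans (upper≤ (mem U zero) ¬bottom) (lower≤ (mem U (suc zero)))

  span≤embed : ∀ U → T (mem U (suc zero)) → span (middles U) ≤ embed U
  span≤embed U top = ≤-trans (≤lower (mem U (suc zero)) top) (≤-upper (mem U zero))

  bottom-full : ∀ (U : Upset (D m)) → T (mem U zero) → ∀ x → T (mem U x)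
  bottom-full U bottom x = up U {zero} {x} _ bottom

  top-mem : ∀ (U : Upset (D m)) x → T (mem U x) → T (mem U (suc zero))
  top-mem U zero bottom   = bottom-full U bottom (suc zero)
  top-mem U (suc zero)    h = h
  top-mem U (suc (suc i)) = up U {suc (suc i)} {suc zero} _

  embed≤⊥ : ∀ U → ¬ T (mem U (suc zero)) → embed U ≤ ⊥
  embed≤⊥ U ¬top = ≤-trans (upper≤ (mem U zero) (λ bottom → ¬top (top-mem U zero bottom)))
                           (lower≤⊥ (mem U (suc zero)) ¬top)

  middle-below-top : ∀ {i : Fin m} y → T (D-≤ᵇ (suc (suc i)) y) → y ≡ suc zero ⊎ suc (suc i) ≡ y
  middle-below-top (suc zero)    _   = inj₁ refl
  middle-below-top (suc (suc j)) i≡j =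
    inj₂ (cong (λ k → suc (suc k)) (toWitness {a? = _ ≟ j} i≡j))

  monotone : ∀ U V → U ⊆ V → embed U ≤ embed V
  monotone U V U⊆V with T? (mem V zero) | T? (mem U (suc zero))
  ... | yes bottomV | _ = ≤-trans ≤-⊤ (⊤≤embed V bottomV)
  ... | no _ | no ¬topU = ≤-trans (embed≤⊥ U ¬topU) ⊥-≤
  ... | no ¬bottomV | yes topU =
    ≤-trans (embed≤span U (λ bottomU → ¬bottomV (U⊆V zero bottomU)))
    (≤-trans (span-mono _ _ (λ i → U⊆V (suc (suc i)))) (span≤embed V (U⊆V (suc zero) topU)))

  reflects : ∀ U V → embed U ≤ embed V → U ⊆ V
  reflects U V U≤V x Ux with T? (mem V zero) | T? (mem U zero) | T? (mem V (suc zero))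
  ... | yes bottomV | _ | _ = bottom-full V bottomV x
  ... | no ¬bottomV | yes bottomU | _ =
    ⊥-elim (⊤≰span (middles V) (≤-trans (⊤≤embed U bottomU) (≤-trans U≤V (embed≤span V ¬bottomV))))
  ... | no _ | no _ | no ¬topV =
    ⊥-elim (base≰⊥ (≤-trans (base≤span (middles U)) (≤-trans (span≤embed U (top-mem U x Ux))
                   (≤-trans U≤V (embed≤⊥ V ¬topV)))))
  ... | no ¬bottomV | no ¬bottomU | yes topV = pointwise x Ux
    where
    pointwise : U ⊆ V
    pointwise zero          bottomU = ⊥-elim (¬bottomU bottomU)
    pointwise (suc zero)    _       = topV
    pointwise (suc (suc i)) Ui      = span-reflects (middles U) (middles V)
      (≤-trans (span≤embed U (top-mem U _ Ui)) (≤-trans U≤V (embed≤span V ¬bottomV))) i Ui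

  meet : ∀ U V → embed U ∧ embed V ≤ embed (Up-∧ (D m) U V)
  meet U V with T? (mem U (suc zero)) | T? (mem V (suc zero)) | T? (mem U zero) | T? (mem V zero)
  ... | no ¬topU | _ | _ | _ = ≤-trans (x∧y≤x _ _) (≤-trans (embed≤⊥ U ¬topU) ⊥-≤)
  ... | _ | no ¬topV | _ | _ = ≤-trans (x∧y≤y _ _) (≤-trans (embed≤⊥ V ¬topV) ⊥-≤)
  ... | _ | _ | yes bottomU | _ =
    ≤-trans (x∧y≤y _ _) (monotone V (Up-∧ (D m) U V) (⊆-∩ V U V (λ x _ → bottom-full U bottomU x) (λ _ v → v)))
  ... | _ | _ | _ | yes bottomV =
    ≤-trans (x∧y≤x _ _) (monotone U (Up-∧ (D m) U V) (⊆-∩ U U V (λ _ u → u) (λ x _ → bottom-full V bottomV x)))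
  ... | yes topU | yes topV | no ¬bottomU | no ¬bottomV =
    ≤-trans (∧-monotonic (embed≤span U ¬bottomU) (embed≤span V ¬bottomV))
    (≤-trans (span-∧ (middles U) (middles V) (middles W) (λ _ u v → Equivalence.from T-∧ (u , v)))
             (span≤embed W (Equivalence.from T-∧ (topU , topV))))
    where W = Up-∧ (D m) U V

  join : ∀ U V → embed (Up-∨ (D m) U V) ≤ embed U ∨ embed V
  join U V with T? (mem U zero) | T? (mem V zero) | T? (mem U (suc zero)) | T? (mem V (suc zero))
  ... | yes bottomU | _ | _ | _ = ≤-trans ≤-⊤ (≤-trans (⊤≤embed U bottomU) (x≤x∨y _ _))
  ... | _ | yes bottomV | _ | _ = ≤-trans ≤-⊤ (≤-trans (⊤≤embed V bottomV) (y≤x∨y _ _))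
  ... | no _ | no _ | no ¬topU | no ¬topV =
    ≤-trans (embed≤⊥ W ([ ¬topU , ¬topV ] ∘ ∪-mem U V (suc zero))) ⊥-≤
    where W = Up-∨ (D m) U V
  ... | no _ | no _ | no ¬topU | yes _ =
    ≤-trans (monotone W V λ x Wx → [ (λ Ux → ⊥-elim (¬topU (top-mem U x Ux))) , (λ Vx → Vx) ] (∪-mem U V x Wx))
            (y≤x∨y _ _)
    where W = Up-∨ (D m) U V
  ... | no _ | no _ | yes _ | no ¬topV =
    ≤-trans (monotone W U λ x Wx → [ (λ Ux → Ux) , (λ Vx → ⊥-elim (¬topV (top-mem V x Vx))) ] (∪-mem U V x Wx))
            (x≤x∨y _ _)
    where W = Up-∨ (D m) U V
  ... | no ¬bottomU | no ¬bottomV | yes topU | yes topV =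
    ≤-trans (embed≤span W ([ ¬bottomU , ¬bottomV ] ∘ ∪-mem U V zero))
    (≤-trans (span-∨ (middles U) (middles V) (middles W) (λ i → ∪-mem U V (suc (suc i))))
             (∨-monotonic (span≤embed U topU) (span≤embed V topV)))
    where W = Up-∨ (D m) U V

  impl : ∀ U V → embed U ⇨ embed V ≤ embed (Up-⇨ (D m) U V)
  impl U V = by-cases (T? (mem U zero)) (T? (mem U (suc zero))) (T? (mem V zero)) (T? (mem V (suc zero)))
                      (all? (λ i → T? (middles U i) →-dec T? (middles V i)))
    where
    R = Up-⇨ (D m) U V

    ⊤≤embed-R : U ⊆ V → ⊤ ≤ embed R
    ⊤≤embed-R U⊆V = ⊤≤embed R (⊆⇒⇨-full U V U⊆V zero)

    by-cases : Dec (T (mem U zero)) → Dec (T (mem U (suc zero))) →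
               Dec (T (mem V zero)) → Dec (T (mem V (suc zero))) →
               Dec (∀ i → T (middles U i) → T (middles V i)) →
               embed U ⇨ embed V ≤ embed R
    by-cases (yes bottomU) _ _ _ _ =
      ≤-trans (⇨-relax (⊤≤embed U bottomU) ≤-refl) (≤-trans ⊤⇨-≤ (monotone V R (⊆-⇨ U V)))
    by-cases (no _) (no ¬topU) _ _ _ =
      ≤-trans ≤-⊤ (⊤≤embed-R (λ x Ux → ⊥-elim (¬topU (top-mem U x Ux))))
    by-cases (no _) (yes _) (yes bottomV) _ _ = ≤-trans ≤-⊤ (⊤≤embed R (⊆-⇨ U V zero bottomV))
    by-cases (no _) (yes topU) (no _) (no ¬topV) _ =
      ≤-trans (⇨-relax (≤-trans (base≤span (middles U)) (span≤embed U topU)) (embed≤⊥ V ¬topV))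
              (≤-trans ¬base≤⊥ ⊥-≤)
    by-cases (no ¬bottomU) (yes _) (no _) (yes topV) (yes middles⊆) = ≤-trans ≤-⊤ (⊤≤embed-R U⊆V)
      where
      U⊆V : U ⊆ V
      U⊆V zero          bottomU = ⊥-elim (¬bottomU bottomU)
      U⊆V (suc zero)    _       = topV
      U⊆V (suc (suc i)) Ui      = middles⊆ i Ui
    by-cases (no ¬bottomU) (yes topU) (no ¬bottomV) (yes topV) (no ¬middles⊆) =
      let k , ¬[Uk⇒Vk] = ¬∀⟶∃¬ m _ (λ i → T? (middles U i) →-dec T? (middles V i)) ¬middles⊆
          Uk , ¬Vk = ¬[T⇒T] ¬[Uk⇒Vk]
      in ≤-trans (⇨-relax (span≤embed U topU) (embed≤span V ¬bottomV))
         (≤-trans (span-⇨ (middles U) (middles V) (middles R) Uk ¬Vk pointwise)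
                  (span≤embed R (⊆-⇨ U V (suc zero) topV)))
      where
      pointwise : ∀ i → (T (middles U i) → T (middles V i)) → T (middles R i)
      pointwise i Ui⇒Vi = mem-⇨ U V (suc (suc i)) λ y i≤y → case middle-below-top y i≤y of λ where
        (inj₁ refl) _ → topV
        (inj₂ refl)   → Ui⇒Vi

  upEmbedding : UpEmbedding (D m) B
  upEmbedding = UpOrderEmbedding.upEmbedding record
    { e        = embed
    ; monotone = monotone
    ; reflects = reflects
    ; meet     = meet
    ; join     = join
    ; impl     = impl
    ; top      = ≤-refl
    ; bottom   = ≤-refl
    }

-- Up to isomorphism this is the interval ↓a; dually, the subframe generated by the point ↑a.
module Restriction (A : HA) (a : HeytingAlgebra.Carrier A) where
  open HeytingLemmas A

  restriction : HA
  restriction = record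
    { Carrier = Carrier ; _≈_ = λ x y → a ∧ x ≈ a ∧ y ; _≤_ = λ x y → a ∧ x ≤ y
    ; _∨_ = _∨_ ; _∧_ = _∧_ ; _⇨_ = _⇨_ ; ⊤ = ⊤ ; ⊥ = ⊥
    ; isHeytingAlgebra = record
      { isBoundedLattice = record
        { isLattice = record
          { isPartialOrder = record
            { isPreorder = record
              { isEquivalence = record { refl = Eq.refl ; sym = Eq.sym ; trans = Eq.trans }
              ; reflexive     = λ ax≈ay → ≤-trans (≤-reflexive ax≈ay) (x∧y≤y _ _)
              ; trans         = λ ax≤y ay≤z → ≤-trans (∧-greatest (x∧y≤x _ _) ax≤y) ay≤z
              }
            ; antisym = λ ax≤y ay≤x → ≤-antisym (∧-greatest (x∧y≤x _ _) ax≤y) (∧-greatest (x∧y≤x _ _) ay≤x)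
            }
          ; supremum = λ x y → ≤-trans (x∧y≤y _ _) (x≤x∨y _ _) , ≤-trans (x∧y≤y _ _) (y≤x∨y _ _)
                              , λ _ → ∧-∨-least
          ; infimum  = λ x y → ≤-trans (x∧y≤y _ _) (x∧y≤x _ _) , ≤-trans (x∧y≤y _ _) (x∧y≤y _ _)
                              , λ _ → ∧-greatest
          }
        ; maximum = λ _ → ≤-⊤
        ; minimum = λ _ → ≤-trans (x∧y≤y _ _) ⊥-≤
        }
      ; exponential = λ _ _ _ → (λ aw∧x≤y → transpose-⇨ (≤-trans (≤-reflexive (∧-assoc _ _ _)) aw∧x≤y))
                              , (λ aw≤x⇨y → ≤-trans (≤-reflexive (Eq.sym (∧-assoc _ _ _))) (transpose-∧ aw≤x⇨y))
      }
    }

  restrict : Hom A restriction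
  restrict = record
    { f      = λ x → x
    ; cong   = λ x≈y → ≤-antisym (∧-monotonic ≤-refl (≤-reflexive x≈y))
                                 (∧-monotonic ≤-refl (≤-reflexive (Eq.sym x≈y)))
    ; pres-∧ = λ _ _ → Eq.refl
    ; pres-∨ = λ _ _ → Eq.refl
    ; pres-⇨ = λ _ _ → Eq.refl
    ; pres-⊤ = Eq.refl
    ; pres-⊥ = Eq.refl
    }

  restrict-surjective : Surjective restrict
  restrict-surjective x = x , Eq.refl

module FiniteLemmas (A : HA) (finite : Finite A) where
  open HeytingLemmas A

  k : ℕ
  k = proj₁ finite

  to : Carrier → Fin k
  to = proj₁ (proj₂ finite)

  from : Fin k → Carrier
  from = proj₁ (proj₂ (proj₂ finite))

  from-to : ∀ x → from (to x) ≈ x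
  from-to = proj₁ (proj₂ (proj₂ (proj₂ finite)))

  to-cong : ∀ {x y} → x ≈ y → to x ≡ to y
  to-cong = proj₂ (proj₂ (proj₂ (proj₂ (proj₂ finite))))

  from-to-≤ : ∀ x → from (to x) ≤ x
  from-to-≤ x = ≤-reflexive (from-to x)

  ≤-from-to : ∀ x → x ≤ from (to x)
  ≤-from-to x = ≤-reflexive (Eq.sym (from-to x))

  infix 4 _≈?_ _≤?_ _<_

  _≈?_ : ∀ x y → Dec (x ≈ y)
  x ≈? y = map′ (λ tx≡ty → Eq.trans (Eq.sym (from-to x)) (Eq.trans (Eq.reflexive (cong from tx≡ty)) (from-to y)))
                to-cong
                (to x ≟ to y)

  _≤?_ : ∀ x y → Dec (x ≤ y)
  _≤?_ = ≈-dec⇒≤-dec _≈?_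

  _<_ : Carrier → Carrier → Set
  x < y = x ≤ y × ¬ y ≤ x

  <-wellFounded : WellFounded _<_
  <-wellFounded = Subrelation.wellFounded <⇒<ᶠ
    (On.wellFounded to (po-wellFounded (On.isPartialOrder from isPartialOrder)))
    where
    <⇒<ᶠ : ∀ {x y} → x < y → from (to x) ≤ from (to y) × ¬ from (to x) ≈ from (to y)
    <⇒<ᶠ {x} {y} (x≤y , y≰x) =
      ≤-trans (from-to-≤ x) (≤-trans x≤y (≤-from-to y)) ,
      λ fx≈fy → y≰x (≤-trans (≤-from-to y) (≤-trans (≤-reflexive (Eq.sym fx≈fy)) (from-to-≤ x)))

  Splits : Carrier → Carrier → Carrier → Set
  Splits u x y = u ≤ x ∨ y × ¬ u ≤ x × ¬ u ≤ y

  splits? : ∀ u x y → Dec (Splits u x y)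
  splits? u x y = (u ≤? x ∨ y) ×-dec ¬? (u ≤? x) ×-dec ¬? (u ≤? y)

  unsplittable-joinPrime : ∀ {u} → ¬ u ≤ ⊥ → ¬ (∃ λ i → ∃ λ j → Splits u (from i) (from j)) → JoinPrime u
  unsplittable-joinPrime {u} u≰⊥ ¬split = record { nonzero = u≰⊥ ; prime = prime }
    where
    prime : ∀ {x y} → u ≤ x ∨ y → u ≤ x ⊎ u ≤ y
    prime {x} {y} u≤x∨y with u ≤? x | u ≤? y
    ... | yes u≤x | _       = inj₁ u≤x
    ... | no _    | yes u≤y = inj₂ u≤y
    ... | no u≰x  | no u≰y  = ⊥-elim (¬split (to x , to y ,
          ≤-trans u≤x∨y (∨-monotonic (≤-from-to x) (≤-from-to y)) ,
          (λ u≤x′ → u≰x (≤-trans u≤x′ (from-to-≤ x))) , (λ u≤y′ → u≰y (≤-trans u≤y′ (from-to-≤ y)))))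

  joinPrime? : ∀ u → Dec (JoinPrime u)
  joinPrime? u with u ≤? ⊥ | any? (λ i → any? (λ j → splits? u (from i) (from j)))
  ... | yes u≤⊥ | _             = no λ jp → JoinPrime.nonzero jp u≤⊥
  ... | no _    | yes (i , j , u≤ij , u≰i , u≰j) = no λ jp → [ u≰i , u≰j ] (JoinPrime.prime jp u≤ij)
  ... | no u≰⊥  | no ¬split     = yes (unsplittable-joinPrime u≰⊥ ¬split)

  joinPrime-below : ∀ {y z} → ¬ y ≤ z → ∃ λ s → JoinPrime s × s ≤ y × ¬ s ≤ z
  joinPrime-below {y} = below (<-wellFounded y)
    where
    shrink : ∀ {y x z} → (∃ λ s → JoinPrime s × s ≤ y ∧ x × ¬ s ≤ z) → ∃ λ s → JoinPrime s × s ≤ y × ¬ s ≤ z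
    shrink (s , jp , s≤yx , s≰z) = s , jp , ≤-trans s≤yx (x∧y≤x _ _) , s≰z

    below : ∀ {y z} → Acc _<_ y → ¬ y ≤ z → ∃ λ s → JoinPrime s × s ≤ y × ¬ s ≤ z
    below {y} {z} (acc rec) y≰z with any? (λ i → any? (λ j → splits? y (from i) (from j)))
    ... | no ¬split = y , unsplittable-joinPrime (λ y≤⊥ → y≰z (≤-trans y≤⊥ ⊥-≤)) ¬split , ≤-refl , y≰z
    ... | yes (i , j , y≤ij , y≰i , y≰j) with y ∧ from i ≤? z | y ∧ from j ≤? z
    ...   | yes yi≤z | yes yj≤z = ⊥-elim (y≰z (≤-trans (∧-greatest ≤-refl y≤ij) (∧-∨-least yi≤z yj≤z)))
    ...   | no yi≰z  | _       = shrink (below (rec (x∧y≤x _ _ , λ y≤yi → y≰i (≤-trans y≤yi (x∧y≤y _ _)))) yi≰z)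
    ...   | yes _    | no yj≰z = shrink (below (rec (x∧y≤x _ _ , λ y≤yj → y≰j (≤-trans y≤yj (x∧y≤y _ _)))) yj≰z)

  ≤-by-joinPrimes : ∀ {x y} → (∀ {s} → JoinPrime s → s ≤ x → s ≤ y) → x ≤ y
  ≤-by-joinPrimes {x} {y} below with x ≤? y
  ... | yes x≤y = x≤y
  ... | no x≰y  = let s , jp , s≤x , s≰y = joinPrime-below x≰y in ⊥-elim (s≰y (below jp s≤x))

  minimal-below : (R : Carrier → Set) → (∀ x → Dec (R x)) → (∀ {x y} → x ≈ y → R x → R y) →
                  ∀ {x} → R x → ∃ λ m → R m × m ≤ x × (∀ {y} → R y → y ≤ m → m ≤ y)
  minimal-below R R? R-resp {x} = go (<-wellFounded x)
    where
    go : ∀ {x} → Acc _<_ x → R x → ∃ λ m → R m × m ≤ x × (∀ {y} → R y → y ≤ m → m ≤ y)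
    go {x} (acc rec) Rx with any? (λ i → R? (from i) ×-dec (from i ≤? x) ×-dec ¬? (x ≤? from i))
    ... | yes (i , Ri , i≤x , x≰i) =
      let m , Rm , m≤i , min = go (rec (i≤x , x≰i)) Ri in m , Rm , ≤-trans m≤i i≤x , min
    ... | no ¬smaller = x , Rx , ≤-refl , minimal
      where
      minimal : ∀ {y} → R y → y ≤ x → x ≤ y
      minimal {y} Ry y≤x with x ≤? y
      ... | yes x≤y = x≤y
      ... | no x≰y  = ⊥-elim (¬smaller (to y , R-resp (Eq.sym (from-to y)) Ry , ≤-trans (from-to-≤ y) y≤x ,
                                        λ x≤y′ → x≰y (≤-trans x≤y′ (from-to-≤ y))))

  -- κ u is the largest element not above u (for u join-prime).
  κ : Carrier → Carrier
  κ u = ⋁ (λ i → if isYes (u ≤? from i) then ⊥ else from i)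

  ≤κ : ∀ {u x} → ¬ u ≤ x → x ≤ κ u
  ≤κ {u} {x} u≰x = ≤-trans (≤-from-to x) (≤-trans (kept (u ≤? from (to x))) (⋁-upper _ (to x)))
    where
    kept : (d : Dec (u ≤ from (to x))) → from (to x) ≤ (if isYes d then ⊥ else from (to x))
    kept (yes u≤x′) = ⊥-elim (u≰x (≤-trans u≤x′ (from-to-≤ x)))
    kept (no _)     = ≤-refl

  ≰κ : ∀ {u} → JoinPrime u → ¬ u ≤ κ u
  ≰κ {u} jp u≤κu = let i , u≤κi = JoinPrime-⋁ jp _ u≤κu in dropped (u ≤? from i) u≤κi
    where
    dropped : ∀ {i} (d : Dec (u ≤ from i)) → ¬ u ≤ (if isYes d then ⊥ else from i)
    dropped (yes _)   u≤⊥ = JoinPrime.nonzero jp u≤⊥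
    dropped (no u≰i) u≤i = u≰i u≤i

module CascadeLemmas (A : HA) (finite : Finite A) (cascade : Cascade A) where
  open HeytingLemmas A
  open FiniteLemmas A finite

  -- If w and u were incomparable, then for Q = κ u ∧ κ v the join-prime a would lie below
  -- neither disjunct of the weak Peirce law at (u, Q).
  cascade-comparable : ∀ {a u v w} → JoinPrime a → JoinPrime u → JoinPrime v → u ≤ a → v ≤ a →
                       ¬ u ≤ v → w ≤ v → ¬ v ≤ w → w ≤ u ⊎ u ≤ w
  cascade-comparable {a} {u} {v} {w} ja ju jv u≤a v≤a u≰v w≤v v≰w with w ≤? u | u ≤? w
  ... | yes w≤u | _       = inj₁ w≤u
  ... | no _    | yes u≤w = inj₂ u≤w
  ... | no w≰u  | no u≰w  = ⊥-elim ([ a≰left , a≰right ] (JoinPrime.prime ja a≤peirce))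
    where
    Q = κ u ∧ κ v

    w≤Q : w ≤ Q
    w≤Q = ∧-greatest (≤κ u≰w) (≤κ v≰w)

    y = v ∧ (Q ⇨ u)

    y≤Q : y ≤ Q
    y≤Q = ∧-greatest (≤κ λ u≤y → u≰v (≤-trans u≤y (x∧y≤x _ _)))
                     (≤κ λ v≤y → w≰u (modus-ponens w≤Q (≤-trans w≤v (≤-trans v≤y (x∧y≤y _ _)))))

    a≤peirce : a ≤ (u ⇨ Q) ∨ (((Q ⇨ u) ⇨ Q) ⇨ Q)
    a≤peirce = ≤-trans ≤-⊤ (≤-reflexive (Eq.sym (cascade u Q)))

    a≰left : ¬ a ≤ u ⇨ Q
    a≰left a≤u⇨Q = ≰κ ju (≤-trans (modus-ponens ≤-refl (≤-trans u≤a a≤u⇨Q)) (x∧y≤x _ _))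

    a≰right : ¬ a ≤ ((Q ⇨ u) ⇨ Q) ⇨ Q
    a≰right a≤… = ≰κ jv (≤-trans (modus-ponens (transpose-⇨ y≤Q) (≤-trans v≤a a≤…)) (x∧y≤y _ _))

module _ (A : HA) where
  open HeytingLemmas A

  record IsRootedAntichain {N : ℕ} (root : Carrier) (leaf : Fin N → Carrier) : Set where
    field
      root-joinPrime    : JoinPrime root
      leaf-joinPrime    : ∀ i → JoinPrime (leaf i)
      leaf-incomparable : ∀ {i j} → i ≢ j → ¬ leaf i ≤ leaf j
      leaf≤root         : ∀ i → leaf i ≤ root
      root-minimal      : ∀ {b} → JoinPrime b → b ≤ root → (∀ i → leaf i ≤ b) → root ≤ b

module RootedAntichainLemmas (A : HA) (finite : Finite A) (cascade : Cascade A) {n : ℕ}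
                             {a : HeytingAlgebra.Carrier A} {q : Fin (suc (suc n)) → HeytingAlgebra.Carrier A}
                             (R : IsRootedAntichain A a q) where
  open HeytingLemmas A
  open FiniteLemmas A finite
  open CascadeLemmas A finite cascade
  open IsRootedAntichain R
  open Restriction A a using (restriction; restrict; restrict-surjective)

  N : ℕ
  N = suc (suc n)

  q≤q⇒≡ : ∀ {i j} → q i ≤ q j → i ≡ j
  q≤q⇒≡ {i} {j} qi≤qj with i ≟ j
  ... | yes i≡j = i≡j
  ... | no i≢j  = ⊥-elim (leaf-incomparable i≢j qi≤qj)

  strictly-below-q⇒≤q : ∀ {s i} → JoinPrime s → s ≤ q i → ¬ q i ≤ s → ∀ j → s ≤ q j
  strictly-below-q⇒≤q {s} {i} js s≤qi qi≰s j with i ≟ j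
  ... | yes refl = s≤qi
  ... | no i≢j   = [ (λ s≤qj → s≤qj) , (λ qj≤s → ⊥-elim (qj≰qi (≤-trans qj≤s s≤qi))) ]′
                     (cascade-comparable root-joinPrime (leaf-joinPrime j) (leaf-joinPrime i)
                                         (leaf≤root j) (leaf≤root i) qj≰qi s≤qi qi≰s)
    where
    qj≰qi = leaf-incomparable (λ j≡i → i≢j (sym j≡i))

  t : Carrier
  t = q zero ∧ q (suc zero)

  strictly-below-q⇒≤t : ∀ {s i} → JoinPrime s → s ≤ q i → ¬ q i ≤ s → s ≤ t
  strictly-below-q⇒≤t js s≤qi qi≰s =
    ∧-greatest (strictly-below-q⇒≤q js s≤qi qi≰s zero) (strictly-below-q⇒≤q js s≤qi qi≰s (suc zero))

  q≰t : ∀ i → ¬ q i ≤ t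
  q≰t zero    q0≤t = leaf-incomparable (λ ()) (≤-trans q0≤t (x∧y≤y _ _))
  q≰t (suc i) qi≤t = leaf-incomparable (λ ()) (≤-trans qi≤t (x∧y≤x _ _))

  t≤q : ∀ i → t ≤ q i
  t≤q i = ≤-by-joinPrimes λ {s} js s≤t → case q zero ≤? s of λ where
    (yes q0≤s) → ⊥-elim (q≰t zero (≤-trans q0≤s s≤t))
    (no q0≰s)  → strictly-below-q⇒≤q js (≤-trans s≤t (x∧y≤x _ _)) q0≰s i

  q∧q≤t : ∀ {i j} → i ≢ j → q i ∧ q j ≤ t
  q∧q≤t {i} {j} i≢j = ≤-by-joinPrimes λ {s} js s≤qij → case q i ≤? s of λ where
    (yes qi≤s) → ⊥-elim (leaf-incomparable i≢j (≤-trans qi≤s (≤-trans s≤qij (x∧y≤y _ _))))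
    (no qi≰s)  → strictly-below-q⇒≤t js (≤-trans s≤qij (x∧y≤x _ _)) qi≰s

  t≤a : t ≤ a
  t≤a = ≤-trans (x∧y≤x _ _) (leaf≤root zero)

  between-q-and-a : ∀ {s k} → JoinPrime s → s ≤ a → q k ≤ s → s ≤ q k ⊎ a ≤ s
  between-q-and-a {s} {k} js s≤a qk≤s with s ≤? q k
  ... | yes s≤qk = inj₁ s≤qk
  ... | no s≰qk  = inj₂ (root-minimal js s≤a q≤s)
    where
    q≤s : ∀ l → q l ≤ s
    q≤s l with q l ≤? s
    ... | yes ql≤s = ql≤s
    ... | no ql≰s  = ⊥-elim ([ (λ qk≤ql → case q≤q⇒≡ qk≤ql of λ where refl → ql≰s qk≤s)
                              , (λ ql≤qk → ql≰s (≤-trans ql≤qk qk≤s)) ]′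
                              (cascade-comparable root-joinPrime (leaf-joinPrime l) js (leaf≤root l) s≤a
                                                  ql≰s qk≤s s≰qk))

  X : Carrier
  X = ⋁ (λ j → q (suc j))

  q≤X : ∀ j → q (suc j) ≤ X
  q≤X = ⋁-upper (λ j → q (suc j))

  q₀≤X⇨t : q zero ≤ X ⇨ t
  q₀≤X⇨t = transpose-⇨ (∧-⋁-least (λ j → q (suc j)) λ j → q∧q≤t {zero} {suc j} (λ ()))

  above-some-q : ∀ {s} → ¬ s ∧ X ≤ t → ∃ λ m → q (suc m) ≤ s
  above-some-q {s} sX≰t =
    let r , jr , r≤sX , r≰t = joinPrime-below sX≰t
        m , r≤qm = JoinPrime-⋁ jr (λ j → q (suc j)) (≤-trans r≤sX (x∧y≤y _ _))
    in case q (suc m) ≤? r of λ where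
      (yes qm≤r) → m , ≤-trans qm≤r (≤-trans r≤sX (x∧y≤x _ _))
      (no qm≰r)  → ⊥-elim (r≰t (strictly-below-q⇒≤t jr r≤qm qm≰r))

  comparable-with-t : ∀ {s} → JoinPrime s → s ≤ a → s ≤ t ⊎ t ≤ s
  comparable-with-t {s} js s≤a with q zero ≤? s | s ≤? q zero
  ... | yes q0≤s | _        = inj₂ (≤-trans (t≤q zero) q0≤s)
  ... | no q0≰s  | yes s≤q0 = inj₁ (strictly-below-q⇒≤t js s≤q0 q0≰s)
  ... | no _     | no s≰q0  = swap (cascade-comparable root-joinPrime js (leaf-joinPrime zero)
                                 s≤a (leaf≤root zero) s≰q0 (t≤q zero) (q≰t zero))

  d : Fin N → Carrier
  d zero    = X ⇨ t
  d (suc j) = q (suc j)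

  d⇨t-least : ∀ i {z} → a ∧ t ≤ z → (∀ j → j ≢ i → a ∧ d j ≤ z) → a ∧ (d i ⇨ t) ≤ z
  d⇨t-least i {z} a∧t≤z a∧d≤z =
    ≤-by-joinPrimes λ js s≤ad → below i js (≤-trans s≤ad (x∧y≤x _ _)) (≤-trans s≤ad (x∧y≤y _ _)) a∧d≤z
    where
    via : ∀ {s x} → s ≤ a → s ≤ x → a ∧ x ≤ z → s ≤ z
    via s≤a s≤x a∧x≤z = ≤-trans (∧-greatest s≤a s≤x) a∧x≤z

    below : ∀ i {s} → JoinPrime s → s ≤ a → s ≤ d i ⇨ t → (∀ j → j ≢ i → a ∧ d j ≤ z) → s ≤ z
    below zero {s} js s≤a s≤d⇨t a∧d≤z with q zero ≤? s | s ≤? X ⇨ t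
    ... | yes q₀≤s | _         = ⊥-elim (q≰t zero (modus-ponens q₀≤X⇨t (≤-trans q₀≤s s≤d⇨t)))
    ... | no _     | yes s≤X⇨t = via s≤a (modus-ponens s≤X⇨t s≤d⇨t) a∧t≤z
    ... | no q₀≰s  | no s≰X⇨t  =
      let m , qm≤s = above-some-q (s≰X⇨t ∘ transpose-⇨) in
      [ (λ s≤qm → via s≤a s≤qm (a∧d≤z (suc m) (λ ())))
      , (λ a≤s → ⊥-elim (q₀≰s (≤-trans (leaf≤root zero) a≤s))) ]′ (between-q-and-a js s≤a qm≤s)
    below (suc i) {s} js s≤a s≤d⇨t a∧d≤z with s ≤? X ⇨ t
    ... | yes s≤X⇨t = via s≤a s≤X⇨t (a∧d≤z zero (λ ()))
    ... | no s≰X⇨t  =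
      let m , qm≤s = above-some-q (s≰X⇨t ∘ transpose-⇨) in
      case between-q-and-a js s≤a qm≤s of λ where
        (inj₂ a≤s)  →
          ⊥-elim (q≰t (suc i) (modus-ponens ≤-refl (≤-trans (leaf≤root (suc i)) (≤-trans a≤s s≤d⇨t))))
        (inj₁ s≤qm) → case m ≟ i of λ where
          (yes refl) → via s≤a (modus-ponens s≤qm s≤d⇨t) a∧t≤z
          (no m≢i)   → via s≤a s≤qm (a∧d≤z (suc m) (m≢i ∘ suc-injective))

  d∧d≤t : ∀ {i j} → i ≢ j → a ∧ (d i ∧ d j) ≤ t
  d∧d≤t {zero}  {zero}  i≢j = ⊥-elim (i≢j refl)
  d∧d≤t {zero}  {suc j} _   = ≤-trans (x∧y≤y _ _) (modus-ponens (≤-trans (x∧y≤y _ _) (q≤X j)) (x∧y≤x _ _))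
  d∧d≤t {suc i} {zero}  _   = ≤-trans (x∧y≤y _ _) (modus-ponens (≤-trans (x∧y≤x _ _) (q≤X i)) (x∧y≤y _ _))
  d∧d≤t {suc i} {suc j} i≢j = ≤-trans (x∧y≤y _ _) (q∧q≤t i≢j)

  d≰t : ∀ i → ¬ a ∧ d i ≤ t
  d≰t zero    a∧d≤t = q≰t zero (≤-trans (∧-greatest (leaf≤root zero) q₀≤X⇨t) a∧d≤t)
  d≰t (suc j) a∧d≤t = q≰t (suc j) (≤-trans (∧-greatest (leaf≤root (suc j)) ≤-refl) a∧d≤t)

  ⊤≰t∨⋁d : ¬ a ∧ ⊤ ≤ t ∨ ⋁ d
  ⊤≰t∨⋁d a∧⊤≤ with JoinPrime.prime root-joinPrime (≤-trans (∧-greatest ≤-refl ≤-⊤) a∧⊤≤)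
  ... | inj₁ a≤t = q≰t zero (≤-trans (leaf≤root zero) a≤t)
  ... | inj₂ a≤⋁d with JoinPrime-⋁ root-joinPrime d a≤⋁d
  ...   | zero  , a≤X⇨t = q≰t (suc zero) (modus-ponens (q≤X zero) (≤-trans (leaf≤root (suc zero)) a≤X⇨t))
  ...   | suc j , a≤qj  = leaf-incomparable (λ ()) (≤-trans (leaf≤root zero) a≤qj)

  span : Span restriction N
  span = record
    { base             = t
    ; point            = d
    ; base≤point       = λ { zero → ≤-trans (x∧y≤y _ _) y≤x⇨y ; (suc j) → ≤-trans (x∧y≤y _ _) (t≤q (suc j)) }
    ; point∧point≤base = d∧d≤t
    ; point⇨base-least = d⇨t-least
    ; point≰base       = d≰t
    ; ⊤≰base∨⋁point    = ⊤≰t∨⋁d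
    }

  ¬t≤⊥ : ¬ t ≤ ⊥ → a ∧ (t ⇨ ⊥) ≤ ⊥
  ¬t≤⊥ t≰⊥ = ≤-by-joinPrimes λ js s≤a∧¬t →
    let s≤¬t = ≤-trans s≤a∧¬t (x∧y≤y _ _) in
    case comparable-with-t js (≤-trans s≤a∧¬t (x∧y≤x _ _)) of λ where
      (inj₁ s≤t) → modus-ponens s≤t s≤¬t
      (inj₂ t≤s) → ⊥-elim (t≰⊥ (modus-ponens ≤-refl (≤-trans t≤s s≤¬t)))

  refutes : RefutesJankov A (F N) ⊎ RefutesJankov A (D N)
  refutes with t ≤? ⊥
  ... | yes t≤⊥ = inj₁ (restriction , restrict , restrict-surjective ,
                        FanEmbedding.upEmbedding span (≤-trans (x∧y≤y _ _) t≤⊥))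
  ... | no t≰⊥  = inj₂ (restriction , restrict , restrict-surjective ,
                        DiamondEmbedding.upEmbedding span
                          (λ a∧t≤⊥ → t≰⊥ (≤-trans (∧-greatest t≤a ≤-refl) a∧t≤⊥)) (¬t≤⊥ t≰⊥))

¬¬-Π-Fin : ∀ {m} {P : Fin m → Set} → (∀ i → ¬ ¬ P i) → ¬ ¬ (∀ i → P i)
¬¬-Π-Fin {zero}  _     ¬all = ¬all (λ ())
¬¬-Π-Fin {suc m} ¬¬P ¬all = ¬¬P zero λ P₀ → ¬¬-Π-Fin (λ i → ¬¬P (suc i)) λ Pₛ →
  ¬all λ { zero → P₀ ; (suc i) → Pₛ i }

∃-Vec? : ∀ {k} m {P : Vec (Fin k) m → Set} → (∀ v → Dec (P v)) → Dec (∃ P)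
∃-Vec? zero    P? = map′ ([] ,_) (λ { ([] , p) → p }) (P? [])
∃-Vec? (suc m) P? = map′ (λ (x , v , p) → x ∷ v , p) (λ { (x ∷ v , p) → x , v , p })
                         (any? λ x → ∃-Vec? m (λ v → P? (x ∷ v)))

module WidthLemmas (A : HA) (finite : Finite A) where
  open HeytingLemmas A
  open FiniteLemmas A finite

  IsRootedAntichain-resp : ∀ {N a a′} {q q′ : Fin N → Carrier} → a ≈ a′ → (∀ i → q i ≈ q′ i) →
                           IsRootedAntichain A a q → IsRootedAntichain A a′ q′
  IsRootedAntichain-resp {a = a} {a′} {q} {q′} a≈a′ q≈q′ R = record
    { root-joinPrime    = JoinPrime-resp-≈ a≈a′ root-joinPrime
    ; leaf-joinPrime    = λ i → JoinPrime-resp-≈ (q≈q′ i) (leaf-joinPrime i)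
    ; leaf-incomparable = λ {i} {j} i≢j qi≤qj →
                            leaf-incomparable i≢j (≤-trans (q≤q′ i) (≤-trans qi≤qj (q′≤q j)))
    ; leaf≤root         = λ i → ≤-trans (q′≤q i) (≤-trans (leaf≤root i) (≤-reflexive a≈a′))
    ; root-minimal      = λ jb b≤a′ q′≤b → ≤-trans (≤-reflexive (Eq.sym a≈a′))
                            (root-minimal jb (≤-trans b≤a′ (≤-reflexive (Eq.sym a≈a′)))
                                          λ i → ≤-trans (q≤q′ i) (q′≤b i))
    }
    where
    open IsRootedAntichain R
    q≤q′ : ∀ i → q i ≤ q′ i
    q≤q′ i = ≤-reflexive (q≈q′ i)
    q′≤q : ∀ i → q′ i ≤ q i
    q′≤q i = ≤-reflexive (Eq.sym (q≈q′ i))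

  isRootedAntichain? : ∀ {N} a (q : Fin N → Carrier) → Dec (IsRootedAntichain A a q)
  isRootedAntichain? a q = map′
    (λ (ja , jq , incomparable , q≤a , minimal) → record
      { root-joinPrime    = ja
      ; leaf-joinPrime    = jq
      ; leaf-incomparable = λ {i} {j} → incomparable i j
      ; leaf≤root         = q≤a
      ; root-minimal      = λ {b} jb b≤a q≤b → ≤-trans
          (minimal (to b) (JoinPrime-resp-≈ (Eq.sym (from-to b)) jb) (≤-trans (from-to-≤ b) b≤a)
                   (λ i → ≤-trans (q≤b i) (≤-from-to b)))
          (from-to-≤ b)
      })
    (λ R → let open IsRootedAntichain R in
      root-joinPrime , leaf-joinPrime , (λ i j → leaf-incomparable) , leaf≤root , λ b → root-minimal)
    (joinPrime? a ×-dec all? (joinPrime? ∘ q) ×-dec all? (λ i → all? λ j → ¬? (i ≟ j) →-dec ¬? (q i ≤? q j))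
     ×-dec all? (λ i → q i ≤? a)
     ×-dec all? (λ b → joinPrime? (from b) →-dec from b ≤? a →-dec all? (λ i → q i ≤? from b)
                       →-dec a ≤? from b))

  rootedAntichain? : ∀ N →
    Dec (∃ λ a → ∃ λ (v : Vec (Fin k) N) → IsRootedAntichain A (from a) (λ i → from (lookup v i)))
  rootedAntichain? N = any? λ a → ∃-Vec? N λ v → isRootedAntichain? (from a) (λ i → from (lookup v i))

  enumerate : ∀ {N a} {q : Fin N → Carrier} → IsRootedAntichain A a q →
              ∃ λ a → ∃ λ (v : Vec (Fin k) N) → IsRootedAntichain A (from a) (λ i → from (lookup v i))
  enumerate {a = a} {q} R = to a , tabulate (to ∘ q) , IsRootedAntichain-resp (Eq.sym (from-to a))
    (λ i → Eq.trans (Eq.sym (from-to (q i))) (Eq.reflexive (cong from (sym (lookup∘tabulate (to ∘ q) i))))) R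

  module Generator (P : PrimeFilter A) (P? : ∀ i → Dec (PrimeFilter.F P (from i))) where
    open PrimeFilter P renaming (F to _∈P)

    _∈?_ : ∀ x → Dec (x ∈P)
    _∈?_ x = map′ (upward (from-to-≤ x)) (upward (≤-from-to x)) (P? (to x))

    least : ∃ λ g → g ∈P × g ≤ ⊤ × (∀ {y} → y ∈P → y ≤ g → g ≤ y)
    least = minimal-below _∈P _∈?_ (λ x≈y → upward (≤-reflexive x≈y)) has-⊤

    generator : Carrier
    generator = proj₁ least

    generator-∈ : generator ∈P
    generator-∈ = proj₁ (proj₂ least)

    -- g ∧ x is in P and below g, so by minimality g ≤ g ∧ x
    generator-≤ : ∀ {x} → x ∈P → generator ≤ x
    generator-≤ x∈P = ≤-trans (proj₂ (proj₂ (proj₂ least)) (closed-∧ generator-∈ x∈P) (x∧y≤x _ _)) (x∧y≤y _ _)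

    generator-joinPrime : JoinPrime generator
    generator-joinPrime = record
      { nonzero = λ g≤⊥ → proper (upward g≤⊥ generator-∈)
      ; prime   = λ g≤x∨y → map-⊎ generator-≤ generator-≤ (prime (upward g≤x∨y generator-∈))
      }

  rootedAntichain-from-primeFilters :
    ∀ {N} (P : PrimeFilter A) (Q : Fin N → PrimeFilter A) →
    (∀ i → Dec (PrimeFilter.F P (from i))) → (∀ j i → Dec (PrimeFilter.F (Q j) (from i))) →
    (∀ j → _⊆F_ A P (Q j)) → (∀ i j → i ≢ j → ¬ _⊆F_ A (Q i) (Q j)) →
    ∃ λ a → ∃ λ (q : Fin N → Carrier) → IsRootedAntichain A a q
  rootedAntichain-from-primeFilters {N} P Q P? Q? P⊆Q Q-incomparable =
    let a , (ja , q≤a) , _ , minimal = minimal-below Above above? Above-resp (GP.generator-joinPrime , q≤p)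
    in a , q , record
      { root-joinPrime    = ja
      ; leaf-joinPrime    = GQ.generator-joinPrime
      ; leaf-incomparable = λ {i} {j} i≢j qi≤qj → Q-incomparable j i (λ j≡i → i≢j (sym j≡i))
          λ x x∈Qj → PrimeFilter.upward (Q i) (≤-trans qi≤qj (GQ.generator-≤ j x∈Qj)) (GQ.generator-∈ i)
      ; leaf≤root         = q≤a
      ; root-minimal      = λ jb b≤a q≤b → minimal (jb , q≤b) b≤a
      }
    where
    module GP = Generator P P?
    module GQ (j : Fin N) = Generator (Q j) (Q? j)

    q : Fin N → Carrier
    q = GQ.generator

    q≤p : ∀ j → q j ≤ GP.generator
    q≤p j = GQ.generator-≤ j (P⊆Q j _ GP.generator-∈)

    Above : Carrier → Set
    Above x = JoinPrime x × (∀ j → q j ≤ x)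

    above? : ∀ x → Dec (Above x)
    above? x = joinPrime? x ×-dec all? (λ j → q j ≤? x)

    Above-resp : ∀ {x y} → x ≈ y → Above x → Above y
    Above-resp x≈y (jx , q≤x) = JoinPrime-resp-≈ x≈y jx , λ j → ≤-trans (q≤x j) (≤-reflexive x≈y)

  -- Membership in a prime filter need not be decidable; as WidthAtMost is a negation, it may be assumed.
  ¬¬-decidable : ∀ (P : PrimeFilter A) → ¬ ¬ (∀ i → Dec (PrimeFilter.F P (from i)))
  ¬¬-decidable P = ¬¬-Π-Fin (λ _ → ¬¬-excluded-middle)

  rootedAntichain-or-width : ∀ n → (∃ λ a → ∃ λ (q : Fin (suc n) → Carrier) → IsRootedAntichain A a q)
                                 ⊎ WidthAtMost A n
  rootedAntichain-or-width n with rootedAntichain? (suc n)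
  ... | yes (a , v , R) = inj₁ (from a , _ , R)
  ... | no ¬R = inj₂ λ P Q P⊆Q Q-incomparable →
    ¬¬-decidable P λ P? → ¬¬-Π-Fin (λ j → ¬¬-decidable (Q j)) λ Q? →
    ¬R (enumerate (proj₂ (proj₂ (rootedAntichain-from-primeFilters P Q P? Q? P⊆Q Q-incomparable))))

open import Data.Nat using (_≤_)

lemma3p9 : (n : ℕ) → 1 ≤ n → (A : HA) → Finite A → SubdirectlyIrreducible A →
    Cascade A → ¬ WidthAtMost A n →
    RefutesJankov A (F (suc n)) ⊎ RefutesJankov A (D (suc n))
lemma3p9 zero    () _ _ _ _ _
lemma3p9 (suc n) _  A finite _ cascade ¬width
  with WidthLemmas.rootedAntichain-or-width A finite (suc n)
... | inj₁ (_ , _ , R) = RootedAntichainLemmas.refutes A finite cascade R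
... | inj₂ width       = ⊥-elim (¬width width)
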